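{- Let $P_3$ denote the path with three edges. If there exists a triangular embedding of $K_n - P_3$ in a closed orientable surface, then $K_n$ has an orientable embedding of type $(6)$.
   Context: $K_n - P_3$ is the graph obtained from the complete graph $K_n$ by deleting the edges of a path with three edges. Embeddings are cellular; the length of a face is the number of corners on its boundary walk; an embedding is triangular if all faces have length 3, and of type $(6)$ if exactly one face has length $6$ and all other faces have length $3$. -}

module Defs where

open import Data.Nat using (ℕ; zero; suc; _<_)
open import Data.Fin using (Fin)
open import Data.Product using (_×_; _,_; ∃)
open import Data.Sum using (_⊎_)
open import Relation.Binary.PropositionalEquality using (_≡_; _≢_)
open import Relation.Nullary using (¬_)

iter : {A : Set} → (A → A) → ℕ → A → A
iter f zero    x = x
iter f (suc k) x = f (iter f k x)

-- A simple graph on the vertex set Fin n, given by its (symmetric, irreflexive)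
-- adjacency relation.
Graph : ℕ → Set₁
Graph n = Fin n → Fin n → Set

K : (n : ℕ) → Graph n
K n u v = u ≢ v

PathEdge : {n : ℕ} → Fin n → Fin n → Fin n → Fin n → Fin n → Fin n → Set
PathEdge a b c d u v =
  ((u ≡ a × v ≡ b) ⊎ (u ≡ b × v ≡ a)) ⊎
  (((u ≡ b × v ≡ c) ⊎ (u ≡ c × v ≡ b)) ⊎
   ((u ≡ c × v ≡ d) ⊎ (u ≡ d × v ≡ c)))

KminusP3 : (n : ℕ) → Fin n → Fin n → Fin n → Fin n → Graph n
KminusP3 n a b c d u v = (u ≢ v) × ¬ PathEdge a b c d u v

-- Four pairwise distinct vertices (so that a-b-c-d is a path with three edges).
Distinct4 : {n : ℕ} → Fin n → Fin n → Fin n → Fin n → Set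
Distinct4 a b c d =
  (a ≢ b) × (a ≢ c) × (a ≢ d) × (b ≢ c) × (b ≢ d) × (c ≢ d)

-- A rotation system of a graph G (= an orientable cellular embedding, by the
-- Heffter–Edmonds–Youngs correspondence): for every vertex v, rot v is a cyclic
-- permutation of the neighbourhood N(v).  rot v u (for u ∈ N(v)) is the
-- neighbour following u in the local rotation at v.
record RotationSystem {n : ℕ} (G : Graph n) : Set where
  field
    rot    : Fin n → Fin n → Fin n
    closed : ∀ v u → G v u → G v (rot v u)
    inj    : ∀ v u w → G v u → G v w → rot v u ≡ rot v w → u ≡ w
    cyclic : ∀ v u w → G v u → G v w → ∃ λ k → iter (rot v) k u ≡ w

  -- Darts (arcs) are pairs (u , v) with G u v.  Face-tracing permutation:
  -- after traversing the arc u→v, leave v along the arc v→(rot v u).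
  face : Fin n × Fin n → Fin n × Fin n
  face (u , v) = v , rot v u

OrbitLength : {A : Set} → (A → A) → A → ℕ → Set
OrbitLength f x k =
  (0 < k) × (iter f k x ≡ x) × (∀ j → 0 < j → j < k → iter f j x ≢ x)

-- The length of the face containing dart (u , v) is the orbit length of that
-- dart under the face-tracing permutation (= number of corners of the face).
FaceLength : {n : ℕ} {G : Graph n} → RotationSystem G → Fin n → Fin n → ℕ → Set
FaceLength R u v k = OrbitLength (RotationSystem.face R) (u , v) k

Triangular : {n : ℕ} {G : Graph n} → RotationSystem G → Set
Triangular {n} {G} R = ∀ u v → G u v → FaceLength R u v 3

-- Embedding of type (6): exactly one face has length 6 (the face containing
-- the dart (u₀ , v₀)); every dart not on that face lies on a face of length 3.
Type6 : {n : ℕ} {G : Graph n} → RotationSystem G → Set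
Type6 {n} {G} R =
  ∃ λ u₀ → ∃ λ v₀ → G u₀ v₀ × FaceLength R u₀ v₀ 6 ×
    (∀ u v → G u v →
       (∃ λ j → iter (RotationSystem.face R) j (u₀ , v₀) ≡ (u , v))
       ⊎ FaceLength R u v 3)

-- Let a-b-c-d be the deleted path.  In the triangular embedding, the dart a→c
-- lies on a triangle a c w and the dart d→b on a triangle d b y.  Re-inserting
-- the three path edges into the local rotations (b between w and c at a; c, a
-- between d and y at b; b, d between a and w at c; c between y and b at d)
-- replaces these two triangles by the triangles a c b and d b c and the
-- hexagon y d c w a b, and leaves every other face untouched.
module Submission where

open import Data.Nat using (ℕ; zero; suc; _+_; _<_; s≤s; z≤n)
open import Data.Fin using (Fin; _≟_)
open import Data.Product using (Σ; _×_; _,_; proj₁; proj₂; ∃)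
open import Data.Product.Properties using (≡-dec; ,-injectiveˡ; ,-injectiveʳ)
open import Data.Sum using (_⊎_; inj₁; inj₂; [_,_]′)
open import Data.Empty using (⊥-elim)
open import Function using (_∘_)
open import Relation.Nullary using (¬_; yes; no; Dec)
open import Relation.Nullary.Decidable using (_×-dec_; _⊎-dec_)
open import Relation.Unary using (_∪_; ｛_｝; _≐_; _∉_)
open import Relation.Binary.Definitions using (DecidableEquality; Symmetric)
open import Relation.Binary.PropositionalEquality

open import Defs

module _ {A : Set} where

  iter-+ : (f : A → A) (j k : ℕ) (x : A) → iter f (j + k) x ≡ iter f j (iter f k x)
  iter-+ f zero    k x = refl
  iter-+ f (suc j) k x = cong f (iter-+ f j k x)

  iter-preserves : {P : A → Set} {f : A → A} → (∀ {x} → P x → P (f x)) →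
                   ∀ k {x} → P x → P (iter f k x)
  iter-preserves         pres zero    px = px
  iter-preserves {P} {f} pres (suc k) px = pres (iter-preserves {P} {f} pres k px)

  Reach : (A → A) → A → A → Set
  Reach f x y = ∃ λ k → iter f k x ≡ y

  Reach-trans : ∀ {f : A → A} {x y z} → Reach f x y → Reach f y z → Reach f x z
  Reach-trans {f} {x} (j , x↦y) (k , y↦z) =
    k + j , trans (iter-+ f k j x) (trans (cong (iter f k) x↦y) y↦z)

  iter-agree : ∀ {f g : A → A} {x} → (∀ j → g (iter f j x) ≡ f (iter f j x)) →
               ∀ j → iter g j x ≡ iter f j x
  iter-agree             agree zero    = refl
  iter-agree {f} {g} {x} agree (suc j) = trans (cong g (iter-agree {f} {g} {x} agree j)) (agree j)

  OrbitLength-agree : ∀ {f g : A → A} {x k} → (∀ j → g (iter f j x) ≡ f (iter f j x)) →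
                      OrbitLength f x k → OrbitLength g x k
  OrbitLength-agree {f} {g} {x} {k} agree (k>0 , returns , minimal) =
    k>0 , trans (iter-agree {f} {g} {x} agree k) returns ,
    λ j j>0 j<k → minimal j j>0 j<k ∘ trans (sym (iter-agree {f} {g} {x} agree j))

  OnTriangle : (A → A) → A → A → Set
  OnTriangle f τ δ = δ ≡ τ ⊎ δ ≡ f τ ⊎ δ ≡ f (f τ)

  onTriangle? : DecidableEquality A → ∀ f τ δ → Dec (OnTriangle f τ δ)
  onTriangle? _≟ᴬ_ f τ δ = δ ≟ᴬ τ ⊎-dec δ ≟ᴬ f τ ⊎-dec δ ≟ᴬ f (f τ)

  offTriangle-step : ∀ {P : A → Set} {f : A → A} →
                     (∀ {x} → P x → P (f x)) → (∀ {x y} → P x → P y → f x ≡ f y → x ≡ y) →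
                     ∀ {τ δ} → P τ → iter f 3 τ ≡ τ → P δ →
                     ¬ OnTriangle f τ δ → ¬ OnTriangle f τ (f δ)
  offTriangle-step pres inj pτ cycle pδ off (inj₁ fδ≡τ) =
    off (inj₂ (inj₂ (inj pδ (pres (pres pτ)) (trans fδ≡τ (sym cycle)))))
  offTriangle-step pres inj pτ cycle pδ off (inj₂ (inj₁ fδ≡fτ)) =
    off (inj₁ (inj pδ pτ fδ≡fτ))
  offTriangle-step pres inj pτ cycle pδ off (inj₂ (inj₂ fδ≡ffτ)) =
    off (inj₂ (inj₁ (inj pδ (pres pτ) fδ≡ffτ)))

record IsCyclicOn {A : Set} (S : A → Set) (r : A → A) : Set where
  field
    closed    : ∀ {u} → S u → S (r u)
    injective : ∀ {u w} → S u → S w → r u ≡ r w → u ≡ w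
    connected : ∀ {u w} → S u → S w → Reach r u w

IsCyclicOn-resp-≐ : ∀ {A : Set} {S S′ : A → Set} {r : A → A} →
                    S ≐ S′ → IsCyclicOn S r → IsCyclicOn S′ r
IsCyclicOn-resp-≐ (S⊆S′ , S′⊆S) C = record
  { closed    = S⊆S′ ∘ closed ∘ S′⊆S
  ; injective = λ su sw → injective (S′⊆S su) (S′⊆S sw)
  ; connected = λ su sw → connected (S′⊆S su) (S′⊆S sw)
  }
  where open IsCyclicOn C

module WithDecidableEquality {A : Set} (_≟ᴬ_ : DecidableEquality A) where

  four-point-elim : (P : A → Set) {a b c d : A} → P a → P b → P c → P d →
                    (∀ {v} → v ≢ a → v ≢ b → v ≢ c → v ≢ d → P v) → ∀ v → P v
  four-point-elim P {a} {b} {c} {d} pa pb pc pd others v with v ≟ᴬ a | v ≟ᴬ b | v ≟ᴬ c | v ≟ᴬ d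
  ... | yes v≡a | _ | _ | _             = subst P (sym v≡a) pa
  ... | no _ | yes v≡b | _ | _          = subst P (sym v≡b) pb
  ... | no _ | no _ | yes v≡c | _       = subst P (sym v≡c) pc
  ... | no _ | no _ | no _ | yes v≡d    = subst P (sym v≡d) pd
  ... | no v≢a | no v≢b | no v≢c | no v≢d = others v≢a v≢b v≢c v≢d

  update : {B : Set} → (A → B) → A → B → A → B
  update f x y z with z ≟ᴬ x
  ... | yes _ = y
  ... | no  _ = f z

  update-at : ∀ {B : Set} (f : A → B) x y → update f x y x ≡ y
  update-at f x y with x ≟ᴬ x
  ... | yes _   = refl
  ... | no  x≢x = ⊥-elim (x≢x refl)

  update-other : ∀ {B : Set} {f : A → B} {x y z} → z ≢ x → update f x y z ≡ f z
  update-other {x = x} {z = z} z≢x with z ≟ᴬ x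
  ... | yes z≡x = ⊥-elim (z≢x z≡x)
  ... | no  _   = refl

  ∈-∪-｛｝ : ∀ {P : A → Set} {x u} → (x ≢ u → P u) → (P ∪ ｛ x ｝) u
  ∈-∪-｛｝ {x = x} {u} P-if-≢ with x ≟ᴬ u
  ... | yes x≡u = inj₂ x≡u
  ... | no  x≢u = inj₁ (P-if-≢ x≢u)

  insertAfter : A → A → (A → A) → A → A
  insertAfter p t r = update (update r t (r p)) p t

  insertAfter-at : ∀ p t r → insertAfter p t r p ≡ t
  insertAfter-at p t r = update-at _ p t

  insertAfter-inserted : ∀ {p t r} → t ≢ p → insertAfter p t r t ≡ r p
  insertAfter-inserted t≢p = trans (update-other t≢p) (update-at _ _ _)

  insertAfter-other : ∀ {p t r u} → u ≢ p → u ≢ t → insertAfter p t r u ≡ r u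
  insertAfter-other u≢p u≢t = trans (update-other u≢p) (update-other u≢t)

  module _ {S : A → Set} {r : A → A} {p t : A}
           (C : IsCyclicOn S r) (p∈S : S p) (t∉S : t ∉ S) where
    open IsCyclicOn C

    private
      r′ : A → A
      r′ = insertAfter p t r

      t≢p : t ≢ p
      t≢p refl = t∉S p∈S

      ∈S⇒≢t : ∀ {u} → S u → u ≢ t
      ∈S⇒≢t su refl = t∉S su

      data Step (u : A) : Set where
        at-p      : u ≡ p → r′ u ≡ t → Step u
        at-t      : u ≡ t → r′ u ≡ r p → Step u
        elsewhere : S u → u ≢ p → r′ u ≡ r u → Step u

      step : ∀ {u} → (S ∪ ｛ t ｝) u → Step u
      step (inj₂ refl) = at-t refl (insertAfter-inserted t≢p)
      step {u} (inj₁ su) with u ≟ᴬ p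
      ... | yes refl = at-p refl (insertAfter-at p t r)
      ... | no  u≢p  = elsewhere su u≢p (insertAfter-other u≢p (∈S⇒≢t su))

      closed′ : ∀ {u} → (S ∪ ｛ t ｝) u → (S ∪ ｛ t ｝) (r′ u)
      closed′ s′ with step s′
      ... | at-p _ e          = inj₂ (sym e)
      ... | at-t _ e          = inj₁ (subst S (sym e) (closed p∈S))
      ... | elsewhere su _ e  = inj₁ (subst S (sym e) (closed su))

      injective′ : ∀ {u w} → (S ∪ ｛ t ｝) u → (S ∪ ｛ t ｝) w → r′ u ≡ r′ w → u ≡ w
      injective′ su sw eq with step su | step sw
      ... | at-p u≡p _ | at-p w≡p _ = trans u≡p (sym w≡p)
      ... | at-t u≡t _ | at-t w≡t _ = trans u≡t (sym w≡t)
      ... | elsewhere su′ _ eu | elsewhere sw′ _ ew =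
        injective su′ sw′ (trans (sym eu) (trans eq ew))
      ... | at-p _ eu | at-t _ ew =
        ⊥-elim (∈S⇒≢t (closed p∈S) (trans (sym ew) (trans (sym eq) eu)))
      ... | at-p _ eu | elsewhere sw′ _ ew =
        ⊥-elim (∈S⇒≢t (closed sw′) (trans (sym ew) (trans (sym eq) eu)))
      ... | at-t _ eu | at-p _ ew =
        ⊥-elim (∈S⇒≢t (closed p∈S) (trans (sym eu) (trans eq ew)))
      ... | elsewhere su′ _ eu | at-p _ ew =
        ⊥-elim (∈S⇒≢t (closed su′) (trans (sym eu) (trans eq ew)))
      ... | at-t _ eu | elsewhere sw′ w≢p ew =
        ⊥-elim (w≢p (sym (injective p∈S sw′ (trans (sym eu) (trans eq ew)))))
      ... | elsewhere su′ u≢p eu | at-t _ ew =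
        ⊥-elim (u≢p (injective su′ p∈S (trans (sym eu) (trans eq ew))))

      reach-next : ∀ {u} → S u → Reach r′ u (r u)
      reach-next {u} su with u ≟ᴬ p
      ... | yes refl = 2 , trans (cong r′ (insertAfter-at p t r)) (insertAfter-inserted t≢p)
      ... | no  u≢p  = 1 , insertAfter-other u≢p (∈S⇒≢t su)

      reach-iter : ∀ k {u} → S u → Reach r′ u (iter r k u)
      reach-iter zero    su = 0 , refl
      reach-iter (suc k) su = Reach-trans (reach-iter k su) (reach-next (iter-preserves {P = S} {f = r} closed k su))

      reach-S : ∀ {u w} → S u → S w → Reach r′ u w
      reach-S su sw with connected su sw
      ... | k , r^k[u]≡w = subst (Reach r′ _) r^k[u]≡w (reach-iter k su)

      connected′ : ∀ {u w} → (S ∪ ｛ t ｝) u → (S ∪ ｛ t ｝) w → Reach r′ u w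
      connected′ (inj₁ su)   (inj₁ sw)   = reach-S su sw
      connected′ (inj₁ su)   (inj₂ refl) = Reach-trans (reach-S su p∈S) (1 , insertAfter-at p t r)
      connected′ (inj₂ refl) (inj₁ sw)   =
        Reach-trans (1 , insertAfter-inserted t≢p) (reach-S (closed p∈S) sw)
      connected′ (inj₂ refl) (inj₂ refl) = 0 , refl

    insertAfter-cyclic : IsCyclicOn (S ∪ ｛ t ｝) (insertAfter p t r)
    insertAfter-cyclic = record
      { closed = closed′ ; injective = injective′ ; connected = connected′ }

module _ {n : ℕ} {G : Graph n} (R : RotationSystem G) where
  open RotationSystem R

  Dart : Fin n × Fin n → Set
  Dart (u , v) = G u v

  cyclic-at : ∀ v → IsCyclicOn (G v) (rot v)
  cyclic-at v = record
    { closed    = closed v _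
    ; injective = inj v _ _
    ; connected = cyclic v _ _
    }

  face-iter-suc : ∀ j δ {p q r} → iter face j δ ≡ (p , q) → rot q p ≡ r →
                  iter face (suc j) δ ≡ (q , r)
  face-iter-suc j δ {q = q} δ↦pq rot[q,p]≡r = trans (cong face δ↦pq) (cong (q ,_) rot[q,p]≡r)

  triangle-corners : ∀ {u v} → FaceLength R u v 3 →
                     rot (rot v u) v ≡ u × rot u (rot v u) ≡ v
  triangle-corners {u} {v} (_ , returns , _) =
    ,-injectiveˡ returns ,
    trans (cong (λ z → rot z (rot v u)) (sym (,-injectiveˡ returns))) (,-injectiveʳ returns)

  triangle-face : ∀ {p q r} → p ≢ q → rot q p ≡ r → rot r q ≡ p → rot p r ≡ q →
                  FaceLength R p q 3
  triangle-face {p} {q} p≢q refl rot[r,q]≡p rot[p,r]≡q =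
    s≤s z≤n ,
    cong₂ _,_ rot[r,q]≡p (trans (cong (λ z → rot z (rot q p)) rot[r,q]≡p) rot[p,r]≡q) ,
    returns
    where
      returns : ∀ j → 0 < j → j < 3 → iter face j (p , q) ≢ (p , q)
      returns 1 _ _ = p≢q ∘ sym ∘ ,-injectiveˡ
      returns 2 _ _ = p≢q ∘ trans (sym rot[r,q]≡p) ∘ ,-injectiveʳ
      returns (suc (suc (suc _))) _ (s≤s (s≤s (s≤s ())))

  module _ (G-sym : Symmetric G) where

    face-dart : ∀ {δ} → Dart δ → Dart (face δ)
    face-dart {u , v} g = closed v u (G-sym g)

    face-injective : ∀ {δ δ′} → Dart δ → Dart δ′ → face δ ≡ face δ′ → δ ≡ δ′
    face-injective {u , v} {u′ , v′} g g′ eq with ,-injectiveˡ eq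
    ... | refl = cong (_, v) (inj v u u′ (G-sym g) (G-sym g′) (,-injectiveʳ eq))

module PathInsertion (n : ℕ) (a b c d : Fin n) (distinct : Distinct4 a b c d)
                     (R : RotationSystem (KminusP3 n a b c d)) (triangular : Triangular R) where
  open RotationSystem R
  open WithDecidableEquality (_≟_ {n})

  G : Graph n
  G = KminusP3 n a b c d

  a≢b : a ≢ b
  a≢b = proj₁ distinct
  a≢c : a ≢ c
  a≢c = proj₁ (proj₂ distinct)
  a≢d : a ≢ d
  a≢d = proj₁ (proj₂ (proj₂ distinct))
  b≢c : b ≢ c
  b≢c = proj₁ (proj₂ (proj₂ (proj₂ distinct)))
  b≢d : b ≢ d
  b≢d = proj₁ (proj₂ (proj₂ (proj₂ (proj₂ distinct))))
  c≢d : c ≢ d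
  c≢d = proj₂ (proj₂ (proj₂ (proj₂ (proj₂ distinct))))

  ab-edge : PathEdge a b c d a b
  ab-edge = inj₁ (inj₁ (refl , refl))
  ba-edge : PathEdge a b c d b a
  ba-edge = inj₁ (inj₂ (refl , refl))
  bc-edge : PathEdge a b c d b c
  bc-edge = inj₂ (inj₁ (inj₁ (refl , refl)))
  cb-edge : PathEdge a b c d c b
  cb-edge = inj₂ (inj₁ (inj₂ (refl , refl)))
  cd-edge : PathEdge a b c d c d
  cd-edge = inj₂ (inj₂ (inj₁ (refl , refl)))
  dc-edge : PathEdge a b c d d c
  dc-edge = inj₂ (inj₂ (inj₂ (refl , refl)))

  pathEdge? : ∀ u v → Dec (PathEdge a b c d u v)
  pathEdge? u v =
    ((u ≟ a ×-dec v ≟ b) ⊎-dec (u ≟ b ×-dec v ≟ a)) ⊎-dec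
    (((u ≟ b ×-dec v ≟ c) ⊎-dec (u ≟ c ×-dec v ≟ b)) ⊎-dec
     ((u ≟ c ×-dec v ≟ d) ⊎-dec (u ≟ d ×-dec v ≟ c)))

  pathEdge-sym : ∀ {u v} → PathEdge a b c d u v → PathEdge a b c d v u
  pathEdge-sym (inj₁ (inj₁ (x , y)))         = inj₁ (inj₂ (y , x))
  pathEdge-sym (inj₁ (inj₂ (x , y)))         = inj₁ (inj₁ (y , x))
  pathEdge-sym (inj₂ (inj₁ (inj₁ (x , y)))) = inj₂ (inj₁ (inj₂ (y , x)))
  pathEdge-sym (inj₂ (inj₁ (inj₂ (x , y)))) = inj₂ (inj₁ (inj₁ (y , x)))
  pathEdge-sym (inj₂ (inj₂ (inj₁ (x , y)))) = inj₂ (inj₂ (inj₂ (y , x)))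
  pathEdge-sym (inj₂ (inj₂ (inj₂ (x , y)))) = inj₂ (inj₂ (inj₁ (y , x)))

  G-sym : Symmetric G
  G-sym (u≢v , ¬pe) = u≢v ∘ sym , ¬pe ∘ pathEdge-sym

  notPathNeighbour : ∀ {u v x} → G u v → PathEdge a b c d u x → v ≢ x
  notPathNeighbour g pe refl = proj₂ g pe

  pathEdge-from-a : ∀ {v} → PathEdge a b c d a v → v ≡ b
  pathEdge-from-a (inj₁ (inj₁ (_ , v≡b)))       = v≡b
  pathEdge-from-a (inj₁ (inj₂ (a≡b , _)))       = ⊥-elim (a≢b a≡b)
  pathEdge-from-a (inj₂ (inj₁ (inj₁ (a≡b , _)))) = ⊥-elim (a≢b a≡b)
  pathEdge-from-a (inj₂ (inj₁ (inj₂ (a≡c , _)))) = ⊥-elim (a≢c a≡c)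
  pathEdge-from-a (inj₂ (inj₂ (inj₁ (a≡c , _)))) = ⊥-elim (a≢c a≡c)
  pathEdge-from-a (inj₂ (inj₂ (inj₂ (a≡d , _)))) = ⊥-elim (a≢d a≡d)

  pathEdge-from-b : ∀ {v} → PathEdge a b c d b v → v ≡ a ⊎ v ≡ c
  pathEdge-from-b (inj₁ (inj₁ (b≡a , _)))       = ⊥-elim (a≢b (sym b≡a))
  pathEdge-from-b (inj₁ (inj₂ (_ , v≡a)))       = inj₁ v≡a
  pathEdge-from-b (inj₂ (inj₁ (inj₁ (_ , v≡c)))) = inj₂ v≡c
  pathEdge-from-b (inj₂ (inj₁ (inj₂ (b≡c , _)))) = ⊥-elim (b≢c b≡c)
  pathEdge-from-b (inj₂ (inj₂ (inj₁ (b≡c , _)))) = ⊥-elim (b≢c b≡c)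
  pathEdge-from-b (inj₂ (inj₂ (inj₂ (b≡d , _)))) = ⊥-elim (b≢d b≡d)

  pathEdge-from-c : ∀ {v} → PathEdge a b c d c v → v ≡ b ⊎ v ≡ d
  pathEdge-from-c (inj₁ (inj₁ (c≡a , _)))       = ⊥-elim (a≢c (sym c≡a))
  pathEdge-from-c (inj₁ (inj₂ (c≡b , _)))       = ⊥-elim (b≢c (sym c≡b))
  pathEdge-from-c (inj₂ (inj₁ (inj₁ (c≡b , _)))) = ⊥-elim (b≢c (sym c≡b))
  pathEdge-from-c (inj₂ (inj₁ (inj₂ (_ , v≡b)))) = inj₁ v≡b
  pathEdge-from-c (inj₂ (inj₂ (inj₁ (_ , v≡d)))) = inj₂ v≡d
  pathEdge-from-c (inj₂ (inj₂ (inj₂ (c≡d , _)))) = ⊥-elim (c≢d c≡d)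

  pathEdge-from-d : ∀ {v} → PathEdge a b c d d v → v ≡ c
  pathEdge-from-d (inj₁ (inj₁ (d≡a , _)))       = ⊥-elim (a≢d (sym d≡a))
  pathEdge-from-d (inj₁ (inj₂ (d≡b , _)))       = ⊥-elim (b≢d (sym d≡b))
  pathEdge-from-d (inj₂ (inj₁ (inj₁ (d≡b , _)))) = ⊥-elim (b≢d (sym d≡b))
  pathEdge-from-d (inj₂ (inj₁ (inj₂ (d≡c , _)))) = ⊥-elim (c≢d (sym d≡c))
  pathEdge-from-d (inj₂ (inj₂ (inj₁ (d≡c , _)))) = ⊥-elim (c≢d (sym d≡c))
  pathEdge-from-d (inj₂ (inj₂ (inj₂ (_ , v≡c)))) = v≡c

  pathEdge-from-other : ∀ {u v} → u ≢ a → u ≢ b → u ≢ c → u ≢ d → ¬ PathEdge a b c d u v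
  pathEdge-from-other u≢a _ _ _ (inj₁ (inj₁ (u≡a , _)))       = u≢a u≡a
  pathEdge-from-other _ u≢b _ _ (inj₁ (inj₂ (u≡b , _)))       = u≢b u≡b
  pathEdge-from-other _ u≢b _ _ (inj₂ (inj₁ (inj₁ (u≡b , _)))) = u≢b u≡b
  pathEdge-from-other _ _ u≢c _ (inj₂ (inj₁ (inj₂ (u≡c , _)))) = u≢c u≡c
  pathEdge-from-other _ _ u≢c _ (inj₂ (inj₂ (inj₁ (u≡c , _)))) = u≢c u≡c
  pathEdge-from-other _ _ _ u≢d (inj₂ (inj₂ (inj₂ (u≡d , _)))) = u≢d u≡d

  neighbourhood-a : G a ∪ ｛ b ｝ ≐ (a ≢_)
  neighbourhood-a =
    (λ { (inj₁ g) → proj₁ g ; (inj₂ refl) → a≢b }) ,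
    λ a≢u → ∈-∪-｛｝ {P = G a} λ b≢u → a≢u , b≢u ∘ sym ∘ pathEdge-from-a

  neighbourhood-b : (G b ∪ ｛ c ｝) ∪ ｛ a ｝ ≐ (b ≢_)
  neighbourhood-b =
    (λ { (inj₁ (inj₁ g)) → proj₁ g ; (inj₁ (inj₂ refl)) → b≢c ; (inj₂ refl) → a≢b ∘ sym }) ,
    λ b≢u → ∈-∪-｛｝ {P = G b ∪ ｛ c ｝} λ a≢u → ∈-∪-｛｝ {P = G b} λ c≢u →
      b≢u , [ a≢u ∘ sym , c≢u ∘ sym ]′ ∘ pathEdge-from-b

  neighbourhood-c : (G c ∪ ｛ b ｝) ∪ ｛ d ｝ ≐ (c ≢_)
  neighbourhood-c =
    (λ { (inj₁ (inj₁ g)) → proj₁ g ; (inj₁ (inj₂ refl)) → b≢c ∘ sym ; (inj₂ refl) → c≢d }) ,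
    λ c≢u → ∈-∪-｛｝ {P = G c ∪ ｛ b ｝} λ d≢u → ∈-∪-｛｝ {P = G c} λ b≢u →
      c≢u , [ b≢u ∘ sym , d≢u ∘ sym ]′ ∘ pathEdge-from-c

  neighbourhood-d : G d ∪ ｛ c ｝ ≐ (d ≢_)
  neighbourhood-d =
    (λ { (inj₁ g) → proj₁ g ; (inj₂ refl) → c≢d ∘ sym }) ,
    λ d≢u → ∈-∪-｛｝ {P = G d} λ c≢u → d≢u , c≢u ∘ sym ∘ pathEdge-from-d

  neighbourhood-other : ∀ {v} → v ≢ a → v ≢ b → v ≢ c → v ≢ d → G v ≐ (v ≢_)
  neighbourhood-other v≢a v≢b v≢c v≢d =
    proj₁ , λ v≢u → v≢u , pathEdge-from-other v≢a v≢b v≢c v≢d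

  G-ac : G a c
  G-ac = a≢c , b≢c ∘ sym ∘ pathEdge-from-a

  G-db : G d b
  G-db = b≢d ∘ sym , b≢c ∘ pathEdge-from-d

  w : Fin n
  w = rot c a

  y : Fin n
  y = rot b d

  rot-w-c : rot w c ≡ a
  rot-w-c = proj₁ (triangle-corners R (triangular a c G-ac))
  rot-a-w : rot a w ≡ c
  rot-a-w = proj₂ (triangle-corners R (triangular a c G-ac))
  rot-y-b : rot y b ≡ d
  rot-y-b = proj₁ (triangle-corners R (triangular d b G-db))
  rot-d-y : rot d y ≡ b
  rot-d-y = proj₂ (triangle-corners R (triangular d b G-db))

  G-cw : G c w
  G-cw = closed c a (G-sym G-ac)
  G-wa : G w a
  G-wa = subst (G w) rot-w-c (closed w c (G-sym G-cw))
  G-by : G b y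
  G-by = closed b d (G-sym G-db)
  G-yd : G y d
  G-yd = subst (G y) rot-y-b (closed y b (G-sym G-by))

  w≢a : w ≢ a
  w≢a = proj₁ G-wa
  w≢b : w ≢ b
  w≢b = notPathNeighbour G-cw cb-edge
  w≢c : w ≢ c
  w≢c = proj₁ G-cw ∘ sym
  w≢d : w ≢ d
  w≢d = notPathNeighbour G-cw cd-edge
  y≢a : y ≢ a
  y≢a = notPathNeighbour G-by ba-edge
  y≢b : y ≢ b
  y≢b = proj₁ G-by ∘ sym
  y≢c : y ≢ c
  y≢c = notPathNeighbour G-by bc-edge
  y≢d : y ≢ d
  y≢d = proj₁ G-yd

  rotA rotB₀ rotB rotC₀ rotC rotD : Fin n → Fin n
  rotA  = insertAfter w b (rot a)
  rotB₀ = insertAfter d c (rot b)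
  rotB  = insertAfter c a rotB₀
  rotC₀ = insertAfter a b (rot c)
  rotC  = insertAfter b d rotC₀
  rotD  = insertAfter y c (rot d)

  rot′ : Fin n → Fin n → Fin n
  rot′ = update (update (update (update rot d rotD) c rotC) b rotB) a rotA

  rot′-a : rot′ a ≡ rotA
  rot′-a = update-at _ a rotA

  rot′-b : rot′ b ≡ rotB
  rot′-b = trans (update-other (a≢b ∘ sym)) (update-at _ b rotB)

  rot′-c : rot′ c ≡ rotC
  rot′-c = trans (update-other (a≢c ∘ sym))
           (trans (update-other (b≢c ∘ sym)) (update-at _ c rotC))

  rot′-d : rot′ d ≡ rotD
  rot′-d = trans (update-other (a≢d ∘ sym))
           (trans (update-other (b≢d ∘ sym))
           (trans (update-other (c≢d ∘ sym)) (update-at _ d rotD)))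

  rot′-other : ∀ {v} → v ≢ a → v ≢ b → v ≢ c → v ≢ d → rot′ v ≡ rot v
  rot′-other v≢a v≢b v≢c v≢d =
    trans (update-other v≢a)
    (trans (update-other v≢b)
    (trans (update-other v≢c) (update-other v≢d)))

  RotatesCyclically : Fin n → Set
  RotatesCyclically v = IsCyclicOn (v ≢_) (rot′ v)

  cyclic-a : RotatesCyclically a
  cyclic-a = subst (IsCyclicOn (a ≢_)) (sym rot′-a) (IsCyclicOn-resp-≐ neighbourhood-a
    (insertAfter-cyclic (cyclic-at R a) (G-sym G-wa) λ g → notPathNeighbour g ab-edge refl))

  cyclic-b : RotatesCyclically b
  cyclic-b = subst (IsCyclicOn (b ≢_)) (sym rot′-b) (IsCyclicOn-resp-≐ neighbourhood-b
    (insertAfter-cyclic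
      (insertAfter-cyclic (cyclic-at R b) (G-sym G-db) λ g → notPathNeighbour g bc-edge refl)
      (inj₂ refl) [ (λ g → notPathNeighbour g ba-edge refl) , a≢c ∘ sym ]′))

  cyclic-c : RotatesCyclically c
  cyclic-c = subst (IsCyclicOn (c ≢_)) (sym rot′-c) (IsCyclicOn-resp-≐ neighbourhood-c
    (insertAfter-cyclic
      (insertAfter-cyclic (cyclic-at R c) (G-sym G-ac) λ g → notPathNeighbour g cb-edge refl)
      (inj₂ refl) [ (λ g → notPathNeighbour g cd-edge refl) , b≢d ]′))

  cyclic-d : RotatesCyclically d
  cyclic-d = subst (IsCyclicOn (d ≢_)) (sym rot′-d) (IsCyclicOn-resp-≐ neighbourhood-d
    (insertAfter-cyclic (cyclic-at R d) (G-sym G-yd) λ g → notPathNeighbour g dc-edge refl))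

  rot′-cyclic : ∀ v → RotatesCyclically v
  rot′-cyclic = four-point-elim RotatesCyclically cyclic-a cyclic-b cyclic-c cyclic-d
    λ {v} v≢a v≢b v≢c v≢d → subst (IsCyclicOn (v ≢_)) (sym (rot′-other v≢a v≢b v≢c v≢d))
      (IsCyclicOn-resp-≐ (neighbourhood-other v≢a v≢b v≢c v≢d) (cyclic-at R v))

  R′ : RotationSystem (K n)
  R′ = record
    { rot    = rot′
    ; closed = λ v _ → IsCyclicOn.closed (rot′-cyclic v)
    ; inj    = λ v _ _ → IsCyclicOn.injective (rot′-cyclic v)
    ; cyclic = λ v _ _ → IsCyclicOn.connected (rot′-cyclic v)
    }

  face′ : Fin n × Fin n → Fin n × Fin n
  face′ = RotationSystem.face R′

  rot′-d-y : rot′ d y ≡ c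
  rot′-d-y = trans (cong-app rot′-d y) (insertAfter-at y c (rot d))
  rot′-c-d : rot′ c d ≡ w
  rot′-c-d = trans (cong-app rot′-c d)
             (trans (insertAfter-inserted (b≢d ∘ sym)) (insertAfter-inserted (a≢b ∘ sym)))
  rot′-w-c : rot′ w c ≡ a
  rot′-w-c = trans (cong-app (rot′-other w≢a w≢b w≢c w≢d) c) rot-w-c
  rot′-a-w : rot′ a w ≡ b
  rot′-a-w = trans (cong-app rot′-a w) (insertAfter-at w b (rot a))
  rot′-b-a : rot′ b a ≡ y
  rot′-b-a = trans (cong-app rot′-b a) (trans (insertAfter-inserted a≢c) (insertAfter-inserted c≢d))
  rot′-y-b : rot′ y b ≡ d
  rot′-y-b = trans (cong-app (rot′-other y≢a y≢b y≢c y≢d) b) rot-y-b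

  rot′-b-d : rot′ b d ≡ c
  rot′-b-d = trans (cong-app rot′-b d)
             (trans (insertAfter-other (c≢d ∘ sym) (a≢d ∘ sym)) (insertAfter-at d c (rot b)))
  rot′-c-b : rot′ c b ≡ d
  rot′-c-b = trans (cong-app rot′-c b) (insertAfter-at b d rotC₀)
  rot′-d-c : rot′ d c ≡ b
  rot′-d-c = trans (cong-app rot′-d c) (trans (insertAfter-inserted (y≢c ∘ sym)) rot-d-y)

  rot′-c-a : rot′ c a ≡ b
  rot′-c-a = trans (cong-app rot′-c a) (trans (insertAfter-other a≢b a≢d) (insertAfter-at a b (rot c)))
  rot′-b-c : rot′ b c ≡ a
  rot′-b-c = trans (cong-app rot′-b c) (insertAfter-at c a rotB₀)
  rot′-a-b : rot′ a b ≡ c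
  rot′-a-b = trans (cong-app rot′-a b) (trans (insertAfter-inserted (w≢b ∘ sym)) rot-a-w)

  hex₁ : iter face′ 1 (y , d) ≡ (d , c)
  hex₁ = face-iter-suc R′ 0 (y , d) refl rot′-d-y
  hex₂ : iter face′ 2 (y , d) ≡ (c , w)
  hex₂ = face-iter-suc R′ 1 (y , d) hex₁ rot′-c-d
  hex₃ : iter face′ 3 (y , d) ≡ (w , a)
  hex₃ = face-iter-suc R′ 2 (y , d) hex₂ rot′-w-c
  hex₄ : iter face′ 4 (y , d) ≡ (a , b)
  hex₄ = face-iter-suc R′ 3 (y , d) hex₃ rot′-a-w
  hex₅ : iter face′ 5 (y , d) ≡ (b , y)
  hex₅ = face-iter-suc R′ 4 (y , d) hex₄ rot′-b-a
  hex₆ : iter face′ 6 (y , d) ≡ (y , d)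
  hex₆ = face-iter-suc R′ 5 (y , d) hex₅ rot′-y-b

  hexagon : FaceLength R′ y d 6
  hexagon = s≤s z≤n , hex₆ , returns
    where
      returns : ∀ j → 0 < j → j < 6 → iter face′ j (y , d) ≢ (y , d)
      returns 1 _ _ = y≢d ∘ sym ∘ ,-injectiveˡ ∘ trans (sym hex₁)
      returns 2 _ _ = y≢c ∘ sym ∘ ,-injectiveˡ ∘ trans (sym hex₂)
      returns 3 _ _ = a≢d ∘ ,-injectiveʳ ∘ trans (sym hex₃)
      returns 4 _ _ = b≢d ∘ ,-injectiveʳ ∘ trans (sym hex₄)
      returns 5 _ _ = y≢b ∘ sym ∘ ,-injectiveˡ ∘ trans (sym hex₅)
      returns (suc (suc (suc (suc (suc (suc _)))))) _ (s≤s (s≤s (s≤s (s≤s (s≤s (s≤s ()))))))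

  AgreesAt : Fin n → Set
  AgreesAt v = ∀ {u} → G u v → (u , v) ≢ (w , a) → (u , v) ≢ (a , c) →
               (u , v) ≢ (d , b) → (u , v) ≢ (y , d) → rot′ v u ≡ rot v u

  agrees-a : AgreesAt a
  agrees-a {u} g ≢wa _ _ _ = trans (cong-app rot′-a u)
    (insertAfter-other (≢wa ∘ cong (_, a)) (notPathNeighbour (G-sym g) ab-edge))

  agrees-b : AgreesAt b
  agrees-b {u} g _ _ ≢db _ = trans (cong-app rot′-b u)
    (trans (insertAfter-other u≢c (notPathNeighbour (G-sym g) ba-edge))
           (insertAfter-other (≢db ∘ cong (_, b)) u≢c))
    where u≢c = notPathNeighbour (G-sym g) bc-edge

  agrees-c : AgreesAt c
  agrees-c {u} g _ ≢ac _ _ = trans (cong-app rot′-c u)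
    (trans (insertAfter-other u≢b (notPathNeighbour (G-sym g) cd-edge))
           (insertAfter-other (≢ac ∘ cong (_, c)) u≢b))
    where u≢b = notPathNeighbour (G-sym g) cb-edge

  agrees-d : AgreesAt d
  agrees-d {u} g _ _ _ ≢yd = trans (cong-app rot′-d u)
    (insertAfter-other (≢yd ∘ cong (_, d)) (notPathNeighbour (G-sym g) dc-edge))

  rot′-agrees : ∀ v → AgreesAt v
  rot′-agrees = four-point-elim AgreesAt agrees-a agrees-b agrees-c agrees-d
    λ v≢a v≢b v≢c v≢d {u} _ _ _ _ _ → cong-app (rot′-other v≢a v≢b v≢c v≢d) u

  OnTriangle-ac OnTriangle-db : Fin n × Fin n → Set
  OnTriangle-ac = OnTriangle face (a , c)
  OnTriangle-db = OnTriangle face (d , b)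

  face′-agrees : ∀ {δ} → Dart R δ → ¬ OnTriangle-ac δ → ¬ OnTriangle-db δ → face′ δ ≡ face δ
  face′-agrees {u , v} g ∉ac ∉db = cong (v ,_) (rot′-agrees v g
    (∉ac ∘ inj₂ ∘ inj₂ ∘ λ e → trans e (cong (w ,_) (sym rot-w-c)))
    (∉ac ∘ inj₁)
    (∉db ∘ inj₁)
    (∉db ∘ inj₂ ∘ inj₂ ∘ λ e → trans e (cong (y ,_) (sym rot-y-b))))

  unchanged-triangle : ∀ {u v} → G u v → ¬ OnTriangle-ac (u , v) → ¬ OnTriangle-db (u , v) → FaceLength R′ u v 3
  unchanged-triangle {u} {v} g ∉ac ∉db = OrbitLength-agree agrees (triangular u v g)
    where
      Untouched : Fin n × Fin n → Set
      Untouched δ = Dart R δ × ¬ OnTriangle-ac δ × ¬ OnTriangle-db δ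

      off : ∀ {τ δ} → Dart R τ → FaceLength R (proj₁ τ) (proj₂ τ) 3 →
            Dart R δ → ¬ OnTriangle face τ δ → ¬ OnTriangle face τ (face δ)
      off gτ τ-triangle = offTriangle-step (face-dart R G-sym) (face-injective R G-sym)
                                           gτ (proj₁ (proj₂ τ-triangle))

      untouched-face : ∀ {δ} → Untouched δ → Untouched (face δ)
      untouched-face (gδ , ∉ac , ∉db) =
        face-dart R G-sym gδ ,
        off {a , c} G-ac (triangular a c G-ac) gδ ∉ac ,
        off {d , b} G-db (triangular d b G-db) gδ ∉db

      agrees : ∀ j → face′ (iter face j (u , v)) ≡ face (iter face j (u , v))
      agrees j with iter-preserves {P = Untouched} {f = face} untouched-face j (g , ∉ac , ∉db)
      ... | gδ , ∉ac′ , ∉db′ = face′-agrees gδ ∉ac′ ∉db′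

  classify : ∀ u v → u ≢ v → (∃ λ j → iter face′ j (y , d) ≡ (u , v)) ⊎ FaceLength R′ u v 3
  classify u v u≢v with pathEdge? u v
  ... | yes (inj₁ (inj₁ (refl , refl))) = inj₁ (4 , hex₄)
  ... | yes (inj₁ (inj₂ (refl , refl))) = inj₂ (triangle-face R′ (a≢b ∘ sym) rot′-a-b rot′-c-a rot′-b-c)
  ... | yes (inj₂ (inj₁ (inj₁ (refl , refl)))) = inj₂ (triangle-face R′ b≢c rot′-c-b rot′-d-c rot′-b-d)
  ... | yes (inj₂ (inj₁ (inj₂ (refl , refl)))) = inj₂ (triangle-face R′ (b≢c ∘ sym) rot′-b-c rot′-a-b rot′-c-a)
  ... | yes (inj₂ (inj₂ (inj₁ (refl , refl)))) = inj₂ (triangle-face R′ c≢d rot′-d-c rot′-b-d rot′-c-b)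
  ... | yes (inj₂ (inj₂ (inj₂ (refl , refl)))) = inj₁ (1 , hex₁)
  ... | no ¬pe with onTriangle? (≡-dec _≟_ _≟_) face (a , c) (u , v)
                  | onTriangle? (≡-dec _≟_ _≟_) face (d , b) (u , v)
  ... | yes (inj₁ refl)        | _ = inj₂ (triangle-face R′ a≢c rot′-c-a rot′-b-c rot′-a-b)
  ... | yes (inj₂ (inj₁ refl)) | _ = inj₁ (2 , hex₂)
  ... | yes (inj₂ (inj₂ refl)) | _ = inj₁ (3 , trans hex₃ (cong (w ,_) (sym rot-w-c)))
  ... | no _ | yes (inj₁ refl)        = inj₂ (triangle-face R′ (b≢d ∘ sym) rot′-b-d rot′-c-b rot′-d-c)
  ... | no _ | yes (inj₂ (inj₁ refl)) = inj₁ (5 , hex₅)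
  ... | no _ | yes (inj₂ (inj₂ refl)) = inj₁ (0 , cong (y ,_) (sym rot-y-b))
  ... | no ∉ac | no ∉db = inj₂ (unchanged-triangle (u≢v , ¬pe) ∉ac ∉db)

  type6 : Type6 R′
  type6 = y , d , y≢d , hexagon , classify

mainTheorem19 : (n : ℕ) (a b c d : Fin n) → Distinct4 a b c d →
    Σ (RotationSystem (KminusP3 n a b c d)) Triangular →
    Σ (RotationSystem (K n)) Type6
mainTheorem19 n a b c d distinct (R , triangular) = R′ , type6
  where open PathInsertion n a b c d distinct R triangular
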